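{- Let $t_n=(-1)^{s_2(n)}$, $h_0=0$, $h_1=1$, and $h_n=t_nh_{n-1}+h_{n-2}$ for $n\ge2$. For every $k\in\mathbb{N}$, $$h_{2^{2k+1}-1}^2+h_{2^{2k+1}+1}^2=h_{2^{2k+1}-2}^2+h_{2^{2k+1}-1}^2=h_{2^{2k+2}-3}.$$
   Context: $s_2(n)$ denotes the number of 1's in the binary expansion of $n$; $(t_n)$ is the Prouhet–Thue–Morse sequence. -}

module Defs where

open import Data.Nat using (ℕ; zero; suc; _+_; _*_; _/_; _%_)
open import Data.Integer using (ℤ; +_; -_) renaming (_+_ to _+ℤ_; _*_ to _*ℤ_)

-- binary digit sum with fuel: s2-aux f n = s₂ n whenever n ≤ f
s2-aux : ℕ → ℕ → ℕ
s2-aux zero    n = 0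
s2-aux (suc f) zero = 0
s2-aux (suc f) n@(suc _) = n % 2 + s2-aux f (n / 2)

s₂ : ℕ → ℕ
s₂ n = s2-aux n n

neg1^ : ℕ → ℤ
neg1^ zero = + 1
neg1^ (suc m) = - neg1^ m

t : ℕ → ℤ
t n = neg1^ (s₂ n)

-- h 0 = 0, h 1 = 1, h n = t n * h (n-1) + h (n-2)  (n ≥ 2)
-- hPair n = (h n , h (n+1))
open import Data.Product using (_×_; _,_; proj₁)

hPair : ℕ → ℤ × ℤ
hPair zero = (+ 0 , + 1)
hPair (suc n) = step (hPair n)
  where
  step : ℤ × ℤ → ℤ × ℤ
  step (a , b) = (b , (t (suc (suc n)) *ℤ b) +ℤ a)

h : ℕ → ℤ
h n = proj₁ (hPair n)

module Submission where

-- With T s = [[0,1],[1,s]], the vector (h n, h (n+1)) is T(t (n+1)) ⋯ T(t 0) applied to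
-- (h (-2), h (-1)).  Because t (2^j + i) = - t i for i < 2^j, the product X j over the first
-- 2^j factors satisfies X (j+1) = Y j X j and Y (j+1) = X j Y j, where Y j is the product with
-- -t in place of t; and Y j = D (X j) D for j ≥ 1, with D = diag(1,-1).  Hence
-- X (j+2) = D (X (j+1)) D · X (j+1), and by alternation D A D = Aᵀ for A = X (2k+1), so that
-- X (2k+2) = Aᵀ A.  Pairing both sides with w = (h (-2), h (-1)) gives
-- |A w|² = h (N-2)² + h (N-1)² = h (2N-1) - h (2N-2) = h (2N-3) for N = 2^(2k+1), since
-- t (2N-1) = 1.  The first equality is h (N+1) = h (N-2), from t N = -1 and t (N+1) = 1.

open import Defs
open import Data.Nat using (ℕ; zero; suc; _+_; _*_; _∸_; _^_; _≤_; _<_; z≤n; s≤s; _/_; _%_)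
open import Data.Nat.Properties
open import Data.Nat.DivMod
open import Data.Nat.Divisibility using (n∣m*n)
open import Data.Integer using (ℤ; -_; 0ℤ; 1ℤ; -1ℤ) renaming (_+_ to _+ℤ_; _*_ to _*ℤ_)
import Data.Integer.Properties as ℤ
open import Data.Product using (_×_; _,_; ∃)
open import Relation.Binary.PropositionalEquality
import Data.Integer.Tactic.RingSolver as ZR
import Data.Nat.Tactic.RingSolver as NR

s2-aux-fuel : ∀ {f g n} → n ≤ f → n ≤ g → s2-aux f n ≡ s2-aux g n
s2-aux-fuel {zero}  {zero}  {zero} _ _ = refl
s2-aux-fuel {zero}  {suc g} {zero} _ _ = refl
s2-aux-fuel {suc f} {zero}  {zero} _ _ = refl
s2-aux-fuel {suc f} {suc g} {zero} _ _ = refl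
s2-aux-fuel {suc f} {suc g} {n@(suc _)} n≤1+f n≤1+g =
  cong (_+_ (n % 2)) (s2-aux-fuel (≤-pred (<-≤-trans n/2<n n≤1+f)) (≤-pred (<-≤-trans n/2<n n≤1+g)))
  where
  n/2<n : n / 2 < n
  n/2<n = m/n<m n 2 (s≤s (s≤s z≤n))

s₂-unfold : ∀ n → s₂ n ≡ n % 2 + s₂ (n / 2)
s₂-unfold zero = refl
s₂-unfold n@(suc m) = cong (_+_ (n % 2)) (s2-aux-fuel (≤-pred (m/n<m n 2 (s≤s (s≤s z≤n)))) ≤-refl)

s₂-[2^j+i] : ∀ j {i} → i < 2 ^ j → s₂ (2 ^ j + i) ≡ suc (s₂ i)
s₂-[2^j+i] zero {zero} _ = refl
s₂-[2^j+i] zero {suc i} (s≤s ())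
s₂-[2^j+i] (suc j) {i} i<2^[1+j] = begin
  s₂ (2 ^ suc j + i)                          ≡⟨ s₂-unfold (2 ^ suc j + i) ⟩
  (2 ^ suc j + i) % 2 + s₂ ((2 ^ suc j + i) / 2) ≡⟨ cong₂ (λ m n → m + s₂ n) rem quot ⟩
  i % 2 + s₂ (2 ^ j + i / 2)                  ≡⟨ cong (_+_ (i % 2)) (s₂-[2^j+i] j i/2<2^j) ⟩
  i % 2 + suc (s₂ (i / 2))                    ≡⟨ +-suc (i % 2) _ ⟩
  suc (i % 2 + s₂ (i / 2))                    ≡⟨ cong suc (s₂-unfold i) ⟨
  suc (s₂ i)                                  ∎
  where
  open ≡-Reasoning
  swap : 2 ^ suc j + i ≡ i + 2 ^ j * 2
  swap = trans (+-comm _ i) (cong (_+_ i) (*-comm 2 (2 ^ j)))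
  rem : (2 ^ suc j + i) % 2 ≡ i % 2
  rem = trans (cong (_% 2) swap) ([m+kn]%n≡m%n i (2 ^ j) 2)
  quot : (2 ^ suc j + i) / 2 ≡ 2 ^ j + i / 2
  quot = begin
    (2 ^ suc j + i) / 2     ≡⟨ cong (_/ 2) swap ⟩
    (i + 2 ^ j * 2) / 2     ≡⟨ +-distrib-/-∣ʳ i (n∣m*n (2 ^ j)) ⟩
    i / 2 + 2 ^ j * 2 / 2   ≡⟨ cong (_+_ (i / 2)) (m*n/n≡m (2 ^ j) 2) ⟩
    i / 2 + 2 ^ j           ≡⟨ +-comm (i / 2) _ ⟩
    2 ^ j + i / 2           ∎
  i/2<2^j : i / 2 < 2 ^ j
  i/2<2^j = m<n*o⇒m/o<n (subst (i <_) (*-comm 2 (2 ^ j)) i<2^[1+j])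

2^j>0 : ∀ j → 0 < 2 ^ j
2^j>0 = m^n>0 2

s₂-2^j∸1 : ∀ j → s₂ (2 ^ j ∸ 1) ≡ j
s₂-2^j∸1 zero = refl
s₂-2^j∸1 (suc j) = begin
  s₂ (2 ^ j + (2 ^ j + 0) ∸ 1)  ≡⟨ cong s₂ (+-∸-assoc (2 ^ j) (≤-trans (2^j>0 j) (m≤m+n _ 0))) ⟩
  s₂ (2 ^ j + (2 ^ j + 0 ∸ 1))  ≡⟨ cong (λ n → s₂ (2 ^ j + (n ∸ 1))) (+-identityʳ (2 ^ j)) ⟩
  s₂ (2 ^ j + (2 ^ j ∸ 1))      ≡⟨ s₂-[2^j+i] j (∸-monoʳ-< {o = 0} (s≤s z≤n) (2^j>0 j)) ⟩
  suc (s₂ (2 ^ j ∸ 1))          ≡⟨ cong suc (s₂-2^j∸1 j) ⟩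
  suc j                         ∎
  where open ≡-Reasoning

t-[2^j+i] : ∀ j {i} → i < 2 ^ j → t (2 ^ j + i) ≡ - t i
t-[2^j+i] j i<2^j = cong neg1^ (s₂-[2^j+i] j i<2^j)

t-2^j : ∀ j → t (2 ^ j) ≡ -1ℤ
t-2^j j = trans (cong t (sym (+-identityʳ (2 ^ j)))) (t-[2^j+i] j (2^j>0 j))

t-2^j∸1 : ∀ j → t (2 ^ j ∸ 1) ≡ neg1^ j
t-2^j∸1 j = cong neg1^ (s₂-2^j∸1 j)

neg1^-even : ∀ k → neg1^ (2 * k) ≡ 1ℤ
neg1^-even zero = refl
neg1^-even (suc k) rewrite +-suc k (k + 0) = trans (ℤ.neg-involutive _) (neg1^-even k)

record Mat : Set where
  constructor mat
  field a b c d : ℤ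

mat-cong : ∀ {a b c d a′ b′ c′ d′} → a ≡ a′ → b ≡ b′ → c ≡ c′ → d ≡ d′ → mat a b c d ≡ mat a′ b′ c′ d′
mat-cong refl refl refl refl = refl

infixl 7 _⊗_
_⊗_ : Mat → Mat → Mat
mat a b c d ⊗ mat a′ b′ c′ d′ =
  mat (a *ℤ a′ +ℤ b *ℤ c′) (a *ℤ b′ +ℤ b *ℤ d′) (c *ℤ a′ +ℤ d *ℤ c′) (c *ℤ b′ +ℤ d *ℤ d′)

I : Mat
I = mat 1ℤ 0ℤ 0ℤ 1ℤ

T : ℤ → Mat
T s = mat 0ℤ 1ℤ 1ℤ s

infix 10 _ᵀ
_ᵀ : Mat → Mat
mat a b c d ᵀ = mat a c b d

-- conj A = D A D with D = diag(1, -1)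
conj : Mat → Mat
conj (mat a b c d) = mat a (- b) (- c) d

act : Mat → ℤ × ℤ → ℤ × ℤ
act (mat a b c d) (x , y) = (a *ℤ x +ℤ b *ℤ y , c *ℤ x +ℤ d *ℤ y)

infix 5 _·_
_·_ : ℤ × ℤ → ℤ × ℤ → ℤ
(x , y) · (x′ , y′) = x *ℤ x′ +ℤ y *ℤ y′

⊗-identityˡ : ∀ A → I ⊗ A ≡ A
⊗-identityˡ (mat a b c d) = mat-cong (e a c) (e b d) (e′ a c) (e′ b d)
  where
  e : ∀ x y → 1ℤ *ℤ x +ℤ 0ℤ *ℤ y ≡ x
  e = ZR.solve-∀
  e′ : ∀ x y → 0ℤ *ℤ x +ℤ 1ℤ *ℤ y ≡ y
  e′ = ZR.solve-∀

⊗-assoc : ∀ A B C → (A ⊗ B) ⊗ C ≡ A ⊗ (B ⊗ C)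
⊗-assoc (mat a b c d) (mat e f g k) (mat p q r s) =
  mat-cong (entry a b e f g k p r) (entry a b e f g k q s) (entry c d e f g k p r) (entry c d e f g k q s)
  where
  entry : ∀ a b e f g k p r →
    (a *ℤ e +ℤ b *ℤ g) *ℤ p +ℤ (a *ℤ f +ℤ b *ℤ k) *ℤ r ≡ a *ℤ (e *ℤ p +ℤ f *ℤ r) +ℤ b *ℤ (g *ℤ p +ℤ k *ℤ r)
  entry = ZR.solve-∀

act-⊗ : ∀ A B v → act (A ⊗ B) v ≡ act A (act B v)
act-⊗ (mat a b c d) (mat e f g k) (x , y) = cong₂ _,_ (entry a b e f g k x y) (entry c d e f g k x y)
  where
  entry : ∀ a b e f g k x y →
    (a *ℤ e +ℤ b *ℤ g) *ℤ x +ℤ (a *ℤ f +ℤ b *ℤ k) *ℤ y ≡ a *ℤ (e *ℤ x +ℤ f *ℤ y) +ℤ b *ℤ (g *ℤ x +ℤ k *ℤ y)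
  entry = ZR.solve-∀

ᵀ-⊗ : ∀ A B → (A ⊗ B) ᵀ ≡ B ᵀ ⊗ A ᵀ
ᵀ-⊗ (mat a b c d) (mat e f g k) = mat-cong (entry a b e g) (entry c d e g) (entry a b f k) (entry c d f k)
  where
  entry : ∀ a b e g → a *ℤ e +ℤ b *ℤ g ≡ e *ℤ a +ℤ g *ℤ b
  entry = ZR.solve-∀

conj-⊗ : ∀ A B → conj (A ⊗ B) ≡ conj A ⊗ conj B
conj-⊗ (mat a b c d) (mat e f g k) =
  mat-cong (entry a b e g) (entry′ a b f k) (entry″ c d e g) (entry‴ c d f k)
  where
  entry : ∀ a b e g → a *ℤ e +ℤ b *ℤ g ≡ a *ℤ e +ℤ (- b) *ℤ (- g)
  entry = ZR.solve-∀
  entry′ : ∀ a b f k → - (a *ℤ f +ℤ b *ℤ k) ≡ a *ℤ (- f) +ℤ (- b) *ℤ k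
  entry′ = ZR.solve-∀
  entry″ : ∀ c d e g → - (c *ℤ e +ℤ d *ℤ g) ≡ (- c) *ℤ e +ℤ d *ℤ (- g)
  entry″ = ZR.solve-∀
  entry‴ : ∀ c d f k → c *ℤ f +ℤ d *ℤ k ≡ (- c) *ℤ (- f) +ℤ d *ℤ k
  entry‴ = ZR.solve-∀

conj-involutive : ∀ A → conj (conj A) ≡ A
conj-involutive (mat a b c d) = mat-cong refl (ℤ.neg-involutive b) (ℤ.neg-involutive c) refl

act-ᵀ-adjoint : ∀ A u v → u · act (A ᵀ) v ≡ act A u · v
act-ᵀ-adjoint (mat a b c d) (x , y) (x′ , y′) = adjoint a b c d x y x′ y′
  where
  adjoint : ∀ a b c d x y x′ y′ →
    x *ℤ (a *ℤ x′ +ℤ c *ℤ y′) +ℤ y *ℤ (b *ℤ x′ +ℤ d *ℤ y′) ≡ (a *ℤ x +ℤ b *ℤ y) *ℤ x′ +ℤ (c *ℤ x +ℤ d *ℤ y) *ℤ y′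
  adjoint = ZR.solve-∀

Tprod : (ℕ → ℤ) → ℕ → Mat
Tprod f zero    = I
Tprod f (suc n) = T (f n) ⊗ Tprod f n

Tprod-+ : ∀ f m n → Tprod f (m + n) ≡ Tprod (λ i → f (n + i)) m ⊗ Tprod f n
Tprod-+ f zero    n = sym (⊗-identityˡ (Tprod f n))
Tprod-+ f (suc m) n = begin
  T (f (m + n)) ⊗ Tprod f (m + n)                               ≡⟨ cong₂ (λ i P → T (f i) ⊗ P) (+-comm m n) (Tprod-+ f m n) ⟩
  T (f (n + m)) ⊗ (Tprod (λ i → f (n + i)) m ⊗ Tprod f n)       ≡⟨ ⊗-assoc (T (f (n + m))) (Tprod (λ i → f (n + i)) m) (Tprod f n) ⟨
  T (f (n + m)) ⊗ Tprod (λ i → f (n + i)) m ⊗ Tprod f n         ∎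
  where open ≡-Reasoning

Tprod-cong : ∀ {f g} n → (∀ {i} → i < n → f i ≡ g i) → Tprod f n ≡ Tprod g n
Tprod-cong zero    f≗g = refl
Tprod-cong (suc n) f≗g = cong₂ (λ s P → T s ⊗ P) (f≗g ≤-refl) (Tprod-cong n (λ i<n → f≗g (m<n⇒m<1+n i<n)))

-- (h (-2), h (-1)), the values that the recurrence assigns to negative indices
w : ℤ × ℤ
w = (-1ℤ , 1ℤ)

hPair≡act-Tprod : ∀ n → hPair n ≡ act (Tprod t (2 + n)) w
hPair≡act-Tprod zero    = refl
hPair≡act-Tprod (suc n) = begin
  (h (suc n) , t (2 + n) *ℤ h (suc n) +ℤ h n)   ≡⟨ cong₂ _,_ (lin₁ (h n) (h (suc n))) (lin₂ (t (2 + n)) (h n) (h (suc n))) ⟩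
  act (T (t (2 + n))) (hPair n)                  ≡⟨ cong (act (T (t (2 + n)))) (hPair≡act-Tprod n) ⟩
  act (T (t (2 + n))) (act (Tprod t (2 + n)) w)  ≡⟨ act-⊗ (T (t (2 + n))) (Tprod t (2 + n)) w ⟨
  act (Tprod t (3 + n)) w                        ∎
  where
  open ≡-Reasoning
  lin₁ : ∀ x y → y ≡ 0ℤ *ℤ x +ℤ 1ℤ *ℤ y
  lin₁ = ZR.solve-∀
  lin₂ : ∀ s x y → s *ℤ y +ℤ x ≡ 1ℤ *ℤ x +ℤ s *ℤ y
  lin₂ = ZR.solve-∀

Tprod-doubling : ∀ {f g} j → (∀ {i} → i < 2 ^ j → f (2 ^ j + i) ≡ g i) →
                 Tprod f (2 ^ suc j) ≡ Tprod g (2 ^ j) ⊗ Tprod f (2 ^ j)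
Tprod-doubling {f} j shift = begin
  Tprod f (2 ^ j + (2 ^ j + 0))                      ≡⟨ cong (λ n → Tprod f (2 ^ j + n)) (+-identityʳ (2 ^ j)) ⟩
  Tprod f (2 ^ j + 2 ^ j)                            ≡⟨ Tprod-+ f (2 ^ j) (2 ^ j) ⟩
  Tprod (λ i → f (2 ^ j + i)) (2 ^ j) ⊗ Tprod f (2 ^ j) ≡⟨ cong (_⊗ Tprod f (2 ^ j)) (Tprod-cong (2 ^ j) shift) ⟩
  Tprod _ (2 ^ j) ⊗ Tprod f (2 ^ j)                  ∎
  where open ≡-Reasoning

X Y : ℕ → Mat
X j = Tprod t (2 ^ j)
Y j = Tprod (λ i → - t i) (2 ^ j)

X-suc : ∀ j → X (suc j) ≡ Y j ⊗ X j
X-suc j = Tprod-doubling j (t-[2^j+i] j)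

Y-suc : ∀ j → Y (suc j) ≡ X j ⊗ Y j
Y-suc j = Tprod-doubling j (λ i<2^j → trans (cong -_ (t-[2^j+i] j i<2^j)) (ℤ.neg-involutive _))

-- conj (T s) = - T (- s), so the signs only cancel in products of even length: hence suc j.
Y≡conj-X : ∀ j → Y (suc j) ≡ conj (X (suc j))
Y≡conj-X zero    = refl
Y≡conj-X (suc j) = begin
  Y (2 + j)                                 ≡⟨ Y-suc (suc j) ⟩
  X (suc j) ⊗ Y (suc j)                     ≡⟨ cong₂ _⊗_ (sym (conj-involutive (X (suc j)))) (Y≡conj-X j) ⟩
  conj (conj (X (suc j))) ⊗ conj (X (suc j)) ≡⟨ cong (λ A → conj A ⊗ conj (X (suc j))) (Y≡conj-X j) ⟨
  conj (Y (suc j)) ⊗ conj (X (suc j))       ≡⟨ conj-⊗ (Y (suc j)) (X (suc j)) ⟨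
  conj (Y (suc j) ⊗ X (suc j))              ≡⟨ cong conj (X-suc (suc j)) ⟨
  conj (X (2 + j))                          ∎
  where open ≡-Reasoning

X-suc-suc : ∀ j → X (2 + j) ≡ conj (X (suc j)) ⊗ X (suc j)
X-suc-suc j = trans (X-suc (suc j)) (cong (_⊗ X (suc j)) (Y≡conj-X j))

ConjSymmetric : Mat → Set
ConjSymmetric A = conj A ≡ A ᵀ

ᵀ⊗-symmetric : ∀ A → (A ᵀ ⊗ A) ᵀ ≡ A ᵀ ⊗ A
ᵀ⊗-symmetric A = ᵀ-⊗ (A ᵀ) A

conj⊗-conjSymmetric : ∀ S → S ᵀ ≡ S → ConjSymmetric (conj S ⊗ S)
conj⊗-conjSymmetric S Sᵀ≡S = begin
  conj (conj S ⊗ S)        ≡⟨ conj-⊗ (conj S) S ⟩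
  conj (conj S) ⊗ conj S   ≡⟨ cong (_⊗ conj S) (conj-involutive S) ⟩
  S ⊗ conj S               ≡⟨ cong (λ A → A ⊗ conj A) Sᵀ≡S ⟨
  S ᵀ ⊗ conj S ᵀ           ≡⟨ ᵀ-⊗ (conj S) S ⟨
  (conj S ⊗ S) ᵀ           ∎
  where open ≡-Reasoning

X-odd-conjSymmetric : ∀ k → ConjSymmetric (X (suc (2 * k)))
X-even≡ᵀ⊗ : ∀ k → X (2 + 2 * k) ≡ X (suc (2 * k)) ᵀ ⊗ X (suc (2 * k))

X-odd-conjSymmetric zero    = refl
X-odd-conjSymmetric (suc k) =
  subst (λ n → ConjSymmetric (X (suc n))) (cong suc (sym (+-suc k (k + 0))))
        (subst ConjSymmetric (sym (X-suc-suc (suc (2 * k)))) (conj⊗-conjSymmetric (X (2 + 2 * k)) S-symmetric))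
  where
  S-symmetric : X (2 + 2 * k) ᵀ ≡ X (2 + 2 * k)
  S-symmetric = subst (λ S → S ᵀ ≡ S) (sym (X-even≡ᵀ⊗ k)) (ᵀ⊗-symmetric (X (suc (2 * k))))

X-even≡ᵀ⊗ k = trans (X-suc-suc (2 * k)) (cong (_⊗ X (suc (2 * k))) (X-odd-conjSymmetric k))

h[N+1]≡h[N∸2] : ∀ j M → 2 ^ suc j ≡ 2 + M → h (2 + M + 1) ≡ h M
h[N+1]≡h[N∸2] j M 2^[1+j]≡2+M = begin
  h (2 + M + 1)                                   ≡⟨ cong h (+-comm (2 + M) 1) ⟩
  t (3 + M) *ℤ (t (2 + M) *ℤ h′ +ℤ h M) +ℤ h′       ≡⟨ cong₂ (λ s s′ → s *ℤ (s′ *ℤ h′ +ℤ h M) +ℤ h′) t[3+M]≡1 t[2+M]≡-1 ⟩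
  1ℤ *ℤ (-1ℤ *ℤ h′ +ℤ h M) +ℤ h′                 ≡⟨ cancel (h M) h′ ⟩
  h M                                             ∎
  where
  open ≡-Reasoning
  h′ : ℤ
  h′ = h (1 + M)
  t[2+M]≡-1 : t (2 + M) ≡ -1ℤ
  t[2+M]≡-1 = trans (cong t (sym 2^[1+j]≡2+M)) (t-2^j (suc j))
  t[3+M]≡1 : t (3 + M) ≡ 1ℤ
  t[3+M]≡1 = trans (cong t (trans (+-comm 1 (2 + M)) (cong (_+ 1) (sym 2^[1+j]≡2+M))))
                   (t-[2^j+i] (suc j) (subst (1 <_) (sym 2^[1+j]≡2+M) (s≤s (s≤s z≤n))))
  cancel : ∀ x y → 1ℤ *ℤ (-1ℤ *ℤ y +ℤ x) +ℤ y ≡ x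
  cancel = ZR.solve-∀

h[N∸2]²+h[N∸1]²≡h[2N∸3] : ∀ k M → 2 ^ suc (2 * k) ≡ 2 + M →
                          h M *ℤ h M +ℤ h (1 + M) *ℤ h (1 + M) ≡ h (2 * (2 + M) ∸ 3)
h[N∸2]²+h[N∸1]²≡h[2N∸3] k M 2^[1+2k]≡2+M = begin
  hPair M · hPair M                  ≡⟨ cong (λ p → p · p) hPair-M ⟩
  act A w · act A w                  ≡⟨ act-ᵀ-adjoint A w (act A w) ⟨
  w · act (A ᵀ) (act A w)            ≡⟨ cong (w ·_) (act-⊗ (A ᵀ) A w) ⟨
  w · act (A ᵀ ⊗ A) w                ≡⟨ cong (λ B → w · act B w) (X-even≡ᵀ⊗ k) ⟨
  w · act (X (2 + 2 * k)) w          ≡⟨ cong (w ·_) hPair-2N∸2 ⟨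
  w · hPair (2 + (M + M))            ≡⟨ cong (λ s → -1ℤ *ℤ x +ℤ 1ℤ *ℤ (s *ℤ x +ℤ y)) t[3+2M]≡1 ⟩
  -1ℤ *ℤ x +ℤ 1ℤ *ℤ (1ℤ *ℤ x +ℤ y)   ≡⟨ cancel x y ⟩
  h (1 + (M + M))                    ≡⟨ cong (λ n → h (n ∸ 3)) (2N≡ M) ⟨
  h (2 * (2 + M) ∸ 3)                ∎
  where
  open ≡-Reasoning
  A : Mat
  A = X (suc (2 * k))
  x y : ℤ
  x = h (2 + (M + M))
  y = h (1 + (M + M))
  2N≡ : ∀ M → 2 * (2 + M) ≡ 2 + (2 + (M + M))
  2N≡ = NR.solve-∀
  hPair-M : hPair M ≡ act A w
  hPair-M = trans (hPair≡act-Tprod M) (cong (λ n → act (Tprod t n) w) (sym 2^[1+2k]≡2+M))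
  2^[2+2k]≡ : 2 ^ (2 + 2 * k) ≡ 2 + (2 + (M + M))
  2^[2+2k]≡ = trans (cong (2 *_) 2^[1+2k]≡2+M) (2N≡ M)
  hPair-2N∸2 : hPair (2 + (M + M)) ≡ act (X (2 + 2 * k)) w
  hPair-2N∸2 = trans (hPair≡act-Tprod (2 + (M + M))) (cong (λ n → act (Tprod t n) w) (sym 2^[2+2k]≡))
  t[2N∸1]≡1 : t (2 ^ (2 + 2 * k) ∸ 1) ≡ 1ℤ
  t[2N∸1]≡1 = begin
    t (2 ^ (2 + 2 * k) ∸ 1)  ≡⟨ t-2^j∸1 (2 + 2 * k) ⟩
    - - neg1^ (2 * k)        ≡⟨ ℤ.neg-involutive _ ⟩
    neg1^ (2 * k)            ≡⟨ neg1^-even k ⟩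
    1ℤ                       ∎
  t[3+2M]≡1 : t (3 + (M + M)) ≡ 1ℤ
  t[3+2M]≡1 = trans (cong (λ n → t (n ∸ 1)) (sym 2^[2+2k]≡)) t[2N∸1]≡1
  cancel : ∀ x y → -1ℤ *ℤ x +ℤ 1ℤ *ℤ (1ℤ *ℤ x +ℤ y) ≡ y
  cancel = ZR.solve-∀

2^[1+j]≡2+_ : ∀ j → ∃ λ M → 2 ^ suc j ≡ 2 + M
2^[1+j]≡2+ j = 2 ^ suc j ∸ 2 , sym (m+[n∸m]≡n (*-monoʳ-≤ 2 (2^j>0 j)))

theorem4 : (k : ℕ) →
    ((h (2 ^ (2 * k + 1) ∸ 1) *ℤ h (2 ^ (2 * k + 1) ∸ 1)) +ℤ (h (2 ^ (2 * k + 1) + 1) *ℤ h (2 ^ (2 * k + 1) + 1))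
      ≡ (h (2 ^ (2 * k + 1) ∸ 2) *ℤ h (2 ^ (2 * k + 1) ∸ 2)) +ℤ (h (2 ^ (2 * k + 1) ∸ 1) *ℤ h (2 ^ (2 * k + 1) ∸ 1)))
    × ((h (2 ^ (2 * k + 1) ∸ 2) *ℤ h (2 ^ (2 * k + 1) ∸ 2)) +ℤ (h (2 ^ (2 * k + 1) ∸ 1) *ℤ h (2 ^ (2 * k + 1) ∸ 1))
      ≡ h (2 ^ (2 * k + 2) ∸ 3))
theorem4 k rewrite +-comm (2 * k) 1 | +-comm (2 * k) 2 with 2^[1+j]≡2+ (2 * k)
... | M , 2^[1+2k]≡2+M rewrite 2^[1+2k]≡2+M =
  trans (cong (h (1 + M) *ℤ h (1 + M) +ℤ_) (cong₂ _*ℤ_ h≡ h≡)) (ℤ.+-comm (h (1 + M) *ℤ h (1 + M)) (h M *ℤ h M)) ,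
  h[N∸2]²+h[N∸1]²≡h[2N∸3] k M 2^[1+2k]≡2+M
  where
  h≡ : h (2 + M + 1) ≡ h M
  h≡ = h[N+1]≡h[N∸2] (2 * k) M 2^[1+2k]≡2+M
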